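{- Let $G$ be a graph of type $X$ with connectors $e_1,e_2,e_3$ (with $e_3$ an edge of the path $P(a_3,b_3)$), let $G'$ be a graph, and let $f$ be a circuit injection from $G$ onto $G'$. Then the edges $f(e_1)$ and $f(e_2)$ of $G'$ do not have a common vertex.
   Context: Graphs are undirected, finite or infinite, without loops or multiple edges; a circuit is a (finite) cycle, regarded as its set of edges. A graph of type $X$ is a graph consisting of two vertex-disjoint circuits $A$ and $B$, two edges $e_1=(a_1,b_1)$ and $e_2=(a_2,b_2)$, and a path $P(a_3,b_3)$ which shares no vertex with $A$ or $B$ except its end vertices $a_3$ and $b_3$, where $a_1,a_2,a_3$ are distinct vertices of $A$ and $b_1,b_2,b_3$ are distinct vertices of $B$; if $e_3$ is any edge of $P(a_3,b_3)$, the graph is said to be of type $X$ with connectors $e_1,e_2,e_3$. A circuit injection from $G$ onto $G'$ is a one-to-one map $f$ from the edge set of $G$ onto the edge set of $G'$ such that $f(C)$ is a circuit of $G'$ whenever $C$ is a circuit of $G$; "onto $G'$" includes the requirement that $G'$ has no isolated vertices. -}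

module Defs where

open import Data.Nat using (ℕ; zero; suc; _+_; _≤_)
open import Data.Fin using (Fin; zero; suc; inject₁)
open import Data.Product using (Σ; ∃; _×_; _,_)
open import Data.Sum using (_⊎_)
open import Relation.Nullary using (¬_)
open import Relation.Binary.PropositionalEquality using (_≡_; _≢_)
open import Function.Definitions using (Injective)

record Graph : Set₁ where
  field
    V   : Set
    E   : Set
    src : E → V
    tgt : E → V
    noLoop : ∀ e → src e ≢ tgt e
    noMulti : ∀ e e' → ((src e' ≡ src e × tgt e' ≡ tgt e) ⊎ (src e' ≡ tgt e × tgt e' ≡ src e)) → e ≡ e'

open Graph public

Joins : (G : Graph) → E G → V G → V G → Set
Joins G e x y = (src G e ≡ x × tgt G e ≡ y) ⊎ (src G e ≡ y × tgt G e ≡ x)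

Incident : (G : Graph) → E G → V G → Set
Incident G e v = (src G e ≡ v) ⊎ (tgt G e ≡ v)

-- cyclic successor on Fin (suc n): i ↦ i + 1 mod (n + 1)
next : ∀ {n} → Fin (suc n) → Fin (suc n)
next {zero} zero = zero
next {suc n} zero = suc zero
next {suc n} (suc i) with next {n} i
... | zero = zero
... | suc j = suc (suc j)

EdgeSet : Graph → Set₁
EdgeSet G = E G → Set

IsCircuit : (G : Graph) → EdgeSet G → Set
IsCircuit G C =
  Σ ℕ λ n → Σ (Fin (3 + n) → V G) λ v → Σ (Fin (3 + n) → E G) λ c →
    Injective _≡_ _≡_ v ×
    (∀ i → Joins G (c i) (v i) (v (next i))) ×
    (∀ x → C x → ∃ λ i → c i ≡ x) ×
    (∀ i → C (c i))

Image : {G G' : Graph} → (E G → E G') → EdgeSet G → EdgeSet G'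
Image {G} f C e' = Σ (E G) λ e → C e × f e ≡ e'

record IsCircuitInjection (G G' : Graph) (f : E G → E G') : Set₁ where
  field
    injective   : Injective _≡_ _≡_ f
    surjective  : ∀ e' → ∃ λ e → f e ≡ e'
    circuits    : ∀ (C : EdgeSet G) → IsCircuit G C → IsCircuit G' (Image {G} {G'} f C)
    noIsolated  : ∀ (v : V G') → ∃ λ e' → Incident G' e' v

-- Circuit A: vertices α₀..α_{nA-1} (nA = 3 + pA), edges cA;
-- circuit B: vertices β, edges cB; path P: vertices π₀..π_{m+1} (m+1 edges cP),
-- π₀ = a₃ = α iA₃, π_{m+1} = b₃ = β jB₃, inner vertices off A and B.
record TypeX (G : Graph) : Set where
  field
    pA pB m : ℕ
    α  : Fin (3 + pA) → V G
    cA : Fin (3 + pA) → E G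
    β  : Fin (3 + pB) → V G
    cB : Fin (3 + pB) → E G
    π  : Fin (2 + m) → V G
    cP : Fin (1 + m) → E G
    α-inj : Injective _≡_ _≡_ α
    β-inj : Injective _≡_ _≡_ β
    π-inj : Injective _≡_ _≡_ π
    cA-joins : ∀ i → Joins G (cA i) (α i) (α (next i))
    cB-joins : ∀ j → Joins G (cB j) (β j) (β (next j))
    cP-joins : ∀ k → Joins G (cP k) (π (inject₁ k)) (π (suc k))
    AB-disjoint : ∀ i j → α i ≢ β j
    i₁ i₂ i₃ : Fin (3 + pA)
    j₁ j₂ j₃ : Fin (3 + pB)
    i₁≢i₂ : i₁ ≢ i₂
    i₁≢i₃ : i₁ ≢ i₃
    i₂≢i₃ : i₂ ≢ i₃
    j₁≢j₂ : j₁ ≢ j₂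
    j₁≢j₃ : j₁ ≢ j₃
    j₂≢j₃ : j₂ ≢ j₃
    e₁ e₂ : E G
    e₁-joins : Joins G e₁ (α i₁) (β j₁)
    e₂-joins : Joins G e₂ (α i₂) (β j₂)
    π-start : π zero ≡ α i₃
    π-end   : π (suc (Data.Fin.fromℕ m)) ≡ β j₃
    π-innerA : ∀ (k : Fin m) i → π (suc (inject₁ k)) ≢ α i
    π-innerB : ∀ (k : Fin m) j → π (suc (inject₁ k)) ≢ β j
    k₃ : Fin (1 + m)
    e₃ : E G
    e₃∈P : e₃ ≡ cP k₃
    vertices : ∀ v → (∃ λ i → α i ≡ v) ⊎ (∃ λ j → β j ≡ v) ⊎ (∃ λ k → π k ≡ v)
    edges : ∀ e → (∃ λ i → cA i ≡ e) ⊎ (∃ λ j → cB j ≡ e) ⊎ (e₁ ≡ e) ⊎ (e₂ ≡ e) ⊎ (∃ λ k → cP k ≡ e)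

open TypeX public

CommonVertex : (G : Graph) → E G → E G → Set
CommonVertex G e e' = ∃ λ v → Incident G e v × Incident G e' v

{-# OPTIONS --safe #-}

-- Images of edges of A never meet images of edges of B: if f(a) and f(b) shared a vertex w, the
-- circuit f(A) would contain a second edge f(a′) at w, while G has a "theta" circuit through a, a′
-- and b (an arc of A between two of a₁, a₂, a₃ containing a and a′, the two corresponding
-- connectors, and an arc of B), whose image would then have three edges at w.
-- Now let D be the theta circuit formed by e₁, e₂, an arc of A from a₁ to a₂ and an arc of B from
-- b₂ to b₁. If f(e₁) and f(e₂) met, they would be consecutive in the circuit f(D), so the other
-- edges of f(D) would form a path of images of A- and B-edges; consecutive edges of a path meet,
-- so these would all be images of A-edges or all of B-edges, yet D contains edges of both kinds.

module Submission where

open import Data.Nat using (ℕ; zero; suc; _+_; _∸_; _≤_; _<_; z≤n; s≤s; s≤s⁻¹; _<?_)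
open import Data.Nat.Properties
open import Data.Fin using (Fin; zero; suc; toℕ; fromℕ; fromℕ<; inject₁)
open import Data.Fin.Properties using (toℕ-fromℕ<; fromℕ<-toℕ; toℕ-injective; toℕ<n; toℕ-inject₁; fromℕ-def; inject₁-injective)
  renaming (suc-injective to Fin-suc-injective)
open import Data.Product using (Σ; ∃; _×_; _,_; proj₁; proj₂; uncurry)
open import Data.Sum using (_⊎_; inj₁; inj₂; [_,_]′; swap)
open import Data.Empty using (⊥; ⊥-elim)
open import Data.List using (List; []; _∷_; _++_; [_]; _∷ʳ_; reverse; length; applyUpTo; tabulate)
open import Data.List.Properties
  using (++-assoc; unfold-reverse; reverse-++; length-++; length-reverse; ∷ʳ-injectiveˡ; applyUpTo-∷ʳ)
open import Data.List.Membership.Propositional using (_∈_)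
open import Data.List.Membership.Propositional.Properties
  using (∈-++⁺ˡ; ∈-++⁺ʳ; ∈-++⁻; ∈-applyUpTo⁺; ∈-applyUpTo⁻; ∈-tabulate⁻)
open import Data.List.Relation.Unary.Any using (here; there)
import Data.List.Relation.Unary.Any.Properties as Any
import Data.List.Relation.Unary.All as All
open import Data.List.Relation.Unary.AllPairs using ([]; _∷_)
open import Data.List.Relation.Unary.Unique.Propositional using (Unique)
import Data.List.Relation.Unary.Unique.Propositional.Properties as Unique
open import Data.List.Relation.Binary.Disjoint.Propositional using (Disjoint)
open import Relation.Nullary using (¬_; yes; no; contradiction)
open import Relation.Binary using (tri<; tri≈; tri>)
open import Relation.Binary.PropositionalEquality hiding ([_])
open import Function using (_∘_; _∘₂_; id; flip)
open import Function.Definitions using (Injective)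
open import Defs

-- Cyclic offsets

next-inject₁ : ∀ {k} (i : Fin k) → next (inject₁ i) ≡ suc i
next-inject₁ {suc k} zero = refl
next-inject₁ {suc k} (suc i) rewrite next-inject₁ i = refl

next-fromℕ : ∀ k → next (fromℕ k) ≡ zero
next-fromℕ zero = refl
next-fromℕ (suc k) rewrite next-fromℕ k = refl

fromℕ-or-inject₁ : ∀ {k} (i : Fin (suc k)) → i ≡ fromℕ k ⊎ ∃ λ j → i ≡ inject₁ j
fromℕ-or-inject₁ {zero} zero = inj₁ refl
fromℕ-or-inject₁ {suc k} zero = inj₂ (zero , refl)
fromℕ-or-inject₁ {suc k} (suc i) with fromℕ-or-inject₁ i
... | inj₁ refl = inj₁ refl
... | inj₂ (j , refl) = inj₂ (suc j , refl)

fromℕ<-inject₁ : ∀ {t k} (t<k : t < k) → fromℕ< (m<n⇒m<1+n t<k) ≡ inject₁ (fromℕ< t<k)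
fromℕ<-inject₁ t<k = toℕ-injective (trans (toℕ-fromℕ< _) (sym (trans (toℕ-inject₁ _) (toℕ-fromℕ< t<k))))

next-injective : ∀ {k} {i j : Fin (suc k)} → next i ≡ next j → i ≡ j
next-injective {k} {i} {j} e with fromℕ-or-inject₁ i | fromℕ-or-inject₁ j
... | inj₁ refl | inj₁ refl = refl
... | inj₁ refl | inj₂ (j′ , refl) with () ← trans (sym (next-fromℕ k)) (trans e (next-inject₁ j′))
... | inj₂ (i′ , refl) | inj₁ refl with () ← trans (sym (next-inject₁ i′)) (trans e (next-fromℕ k))
... | inj₂ (i′ , refl) | inj₂ (j′ , refl) with refl ← trans (sym (next-inject₁ i′)) (trans e (next-inject₁ j′)) = refl

module _ {k : ℕ} where

  infixl 6 _⊕_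

  _⊕_ : Fin (suc k) → ℕ → Fin (suc k)
  i ⊕ zero = i
  i ⊕ suc t = next (i ⊕ t)

  ⊕-+ : ∀ i s t → i ⊕ (s + t) ≡ i ⊕ t ⊕ s
  ⊕-+ i zero t = refl
  ⊕-+ i (suc s) t = cong next (⊕-+ i s t)

  ⊕-swap : ∀ i s t → i ⊕ s ⊕ t ≡ i ⊕ t ⊕ s
  ⊕-swap i s t = trans (sym (⊕-+ i t s)) (trans (cong (i ⊕_) (+-comm t s)) (⊕-+ i s t))

  ⊕-cancelʳ : ∀ {i j} t → i ⊕ t ≡ j ⊕ t → i ≡ j
  ⊕-cancelʳ zero e = e
  ⊕-cancelʳ (suc t) e = ⊕-cancelʳ t (next-injective e)

  zero⊕ : ∀ {t} (t<N : t < suc k) → zero ⊕ t ≡ fromℕ< t<N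
  zero⊕ {zero} _ = refl
  zero⊕ {suc t} t<N = begin
    next (zero ⊕ t)                        ≡⟨ cong next (zero⊕ (m<n⇒m<1+n (s≤s⁻¹ t<N))) ⟩
    next (fromℕ< (m<n⇒m<1+n (s≤s⁻¹ t<N))) ≡⟨ cong next (fromℕ<-inject₁ (s≤s⁻¹ t<N)) ⟩
    next (inject₁ (fromℕ< (s≤s⁻¹ t<N)))   ≡⟨ next-inject₁ _ ⟩
    suc (fromℕ< (s≤s⁻¹ t<N))               ∎
    where open ≡-Reasoning

  zero⊕toℕ : ∀ i → zero ⊕ toℕ i ≡ i
  zero⊕toℕ i = trans (zero⊕ (toℕ<n i)) (fromℕ<-toℕ i (toℕ<n i))

  ⊕-as-zero⊕ : ∀ i t → i ⊕ t ≡ zero ⊕ t ⊕ toℕ i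
  ⊕-as-zero⊕ i t = trans (cong (_⊕ t) (sym (zero⊕toℕ i))) (⊕-swap zero (toℕ i) t)

  ⊕-periodic : ∀ i → i ⊕ suc k ≡ i
  ⊕-periodic i = begin
    i ⊕ suc k                 ≡⟨ ⊕-as-zero⊕ i (suc k) ⟩
    next (zero ⊕ k) ⊕ toℕ i   ≡⟨ cong (λ j → next j ⊕ toℕ i) (trans (zero⊕ ≤-refl) (sym (fromℕ-def k))) ⟩
    next (fromℕ k) ⊕ toℕ i    ≡⟨ cong (_⊕ toℕ i) (next-fromℕ k) ⟩
    zero ⊕ toℕ i              ≡⟨ zero⊕toℕ i ⟩
    i                         ∎
    where open ≡-Reasoning

  ⊕-injective : ∀ i {s t} → s < suc k → t < suc k → i ⊕ s ≡ i ⊕ t → s ≡ t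
  ⊕-injective i {s} {t} s<N t<N e = begin
    s                   ≡⟨ sym (toℕ-fromℕ< s<N) ⟩
    toℕ (fromℕ< s<N)    ≡⟨ cong toℕ (trans (sym (zero⊕ s<N)) (trans zero⊕s≡zero⊕t (zero⊕ t<N))) ⟩
    toℕ (fromℕ< t<N)    ≡⟨ toℕ-fromℕ< t<N ⟩
    t                   ∎
    where
      open ≡-Reasoning
      zero⊕s≡zero⊕t : zero ⊕ s ≡ zero ⊕ t
      zero⊕s≡zero⊕t = ⊕-cancelʳ (toℕ i) (trans (sym (⊕-as-zero⊕ i s)) (trans e (⊕-as-zero⊕ i t)))

  next-⊕ : ∀ i t → next i ⊕ t ≡ next (i ⊕ t)
  next-⊕ i t = ⊕-swap i 1 t

  zero⊕-surjective : ∀ s j → ∃ λ t → t < suc k × zero ⊕ s ⊕ t ≡ j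
  zero⊕-surjective zero j = toℕ j , toℕ<n j , zero⊕toℕ j
  zero⊕-surjective (suc s) j with zero⊕-surjective s j
  ... | suc t , t<N , e = t , <-trans (n<1+n t) t<N , trans (next-⊕ (zero ⊕ s) t) e
  ... | zero , _ , e = k , ≤-refl , trans (next-⊕ (zero ⊕ s) k) (trans (⊕-periodic (zero ⊕ s)) e)

  ⊕-surjective : ∀ i j → ∃ λ t → t < suc k × i ⊕ t ≡ j
  ⊕-surjective i j with zero⊕-surjective (toℕ i) j
  ... | t , t<N , e = t , t<N , trans (cong (_⊕ t) (sym (zero⊕toℕ i))) e

  ⊕-rebase : ∀ i {t u} → t ≤ u → i ⊕ t ⊕ (u ∸ t) ≡ i ⊕ u
  ⊕-rebase i {t} {u} t≤u = trans (sym (⊕-+ i (u ∸ t) t)) (cong (i ⊕_) (m∸n+n≡m t≤u))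

  ⊕-wrap : ∀ i {t} u → t ≤ suc k → i ⊕ t ⊕ (u + (suc k ∸ t)) ≡ i ⊕ u
  ⊕-wrap i {t} u t≤N = begin
    i ⊕ t ⊕ (u + (suc k ∸ t))   ≡⟨ ⊕-+ (i ⊕ t) u (suc k ∸ t) ⟩
    i ⊕ t ⊕ (suc k ∸ t) ⊕ u     ≡⟨ cong (_⊕ u) (trans (⊕-rebase i t≤N) (⊕-periodic i)) ⟩
    i ⊕ u                       ∎
    where open ≡-Reasoning

  ⊕-offset-nonzero : ∀ {i j t} → i ≢ j → i ⊕ t ≡ j → 0 < t
  ⊕-offset-nonzero {t = zero} i≢j e = contradiction e i≢j
  ⊕-offset-nonzero {t = suc t} _ _ = s≤s z≤n

  Covers : Fin (suc k) → ℕ → Fin (suc k) → Set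
  Covers i d a = ∃ λ u → u < d × i ⊕ u ≡ a

  covers-mono : ∀ {i d d′ a} → d ≤ d′ → Covers i d a → Covers i d′ a
  covers-mono d≤d′ (u , u<d , e) = u , <-≤-trans u<d d≤d′ , e

  covers-rebase : ∀ {i t u d a} → t ≤ u → u < d + t → i ⊕ u ≡ a → Covers (i ⊕ t) d a
  covers-rebase {i} {t} {u} {d} t≤u u<d+t e =
    u ∸ t , +-cancelʳ-< t (u ∸ t) d (subst (_< d + t) (sym (m∸n+n≡m t≤u)) u<d+t) , trans (⊕-rebase i t≤u) e

  covers-wrap : ∀ {i t u d a} → t ≤ suc k → u < d → i ⊕ u ≡ a → Covers (i ⊕ t) (d + (suc k ∸ t)) a
  covers-wrap {i} {t} {u} t≤N u<d e = u + (suc k ∸ t) , +-monoˡ-< _ u<d , trans (⊕-wrap i u t≤N) e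

  record Arc (i j : Fin (suc k)) : Set where
    field
      steps : ℕ
      steps<N : steps < suc k
      ends : i ⊕ steps ≡ j

  some-arc : ∀ i j → Arc i j
  some-arc i j with ⊕-surjective i j
  ... | t , t<N , e = record { steps = t ; steps<N = t<N ; ends = e }

  arc-covering : ∀ {i j} → i ≢ j → ∀ a →
    (Σ (Arc i j) λ r → Covers i (Arc.steps r) a) ⊎ (Σ (Arc j i) λ r → Covers j (Arc.steps r) a)
  arc-covering {i} {j} i≢j a with ⊕-surjective i a | ⊕-surjective i j
  ... | u , u<N , eₐ | t , t<N , refl with u <? t
  ... | yes u<t = inj₁ (record { steps = t ; steps<N = t<N ; ends = refl } , u , u<t , eₐ)
  ... | no u≮t = inj₂ (record { steps = suc k ∸ t ; steps<N = ∸-monoʳ-< 0<t (<⇒≤ t<N) ; ends = ⊕-wrap i 0 (<⇒≤ t<N) } ,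
                      covers-rebase (≮⇒≥ u≮t) (subst (u <_) (sym (m∸n+n≡m (<⇒≤ t<N))) u<N) eₐ)
    where
      0<t : 0 < t
      0<t = ⊕-offset-nonzero i≢j refl

  record ArcCovering {L : Set} (P : L → Fin (suc k)) (a a′ : Fin (suc k)) : Set where
    field
      from to : L
      from≢to : from ≢ to
      arc : Arc (P from) (P to)
      covers : Covers (P from) (Arc.steps arc) a
      covers′ : Covers (P from) (Arc.steps arc) a′

  -- Three points cut the cycle into three arcs; two edges lie in at most two of them, and the
  -- union of those two arcs is an arc between two of the points.
  module OrderedThreePoints {L : Set} (P : L → Fin (suc k)) {x y z : L} (x≢y : x ≢ y) (x≢z : x ≢ z) (y≢z : y ≢ z)
    {ty tz : ℕ} (0<ty : 0 < ty) (ty<tz : ty < tz) (tz<N : tz < suc k) (ey : P x ⊕ ty ≡ P y) (ez : P x ⊕ tz ≡ P z) where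

    ty≤N : ty ≤ suc k
    ty≤N = <⇒≤ (<-trans ty<tz tz<N)

    data Region (t : ℕ) : Set where
      first : t < ty → Region t
      second : ty ≤ t → t < tz → Region t
      third : tz ≤ t → Region t

    region : ∀ t → Region t
    region t with t <? ty | t <? tz
    ... | yes t<ty | _ = first t<ty
    ... | no t≮ty | yes t<tz = second (≮⇒≥ t≮ty) t<tz
    ... | no _ | no t≮tz = third (≮⇒≥ t≮tz)

    arcXZ : Arc (P x) (P z)
    arcXZ = record { steps = tz ; steps<N = tz<N ; ends = ez }

    arcYX : Arc (P y) (P x)
    arcYX = record
      { steps = suc k ∸ ty
      ; steps<N = ∸-monoʳ-< 0<ty ty≤N
      ; ends = subst (λ j → j ⊕ (suc k ∸ ty) ≡ P x) ey (⊕-wrap (P x) 0 ty≤N)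
      }

    arcZY : Arc (P z) (P y)
    arcZY = record
      { steps = ty + (suc k ∸ tz)
      ; steps<N = subst (ty + (suc k ∸ tz) <_) (m+[n∸m]≡n (<⇒≤ tz<N)) (+-monoˡ-< (suc k ∸ tz) ty<tz)
      ; ends = subst (λ j → j ⊕ (ty + (suc k ∸ tz)) ≡ P y) ez (trans (⊕-wrap (P x) ty (<⇒≤ tz<N)) ey)
      }

    module _ {t a} (t<N : t < suc k) (e : P x ⊕ t ≡ a) where

      coversXZ : t < tz → Covers (P x) tz a
      coversXZ t<tz = t , t<tz , e

      coversYX : ty ≤ t → Covers (P y) (suc k ∸ ty) a
      coversYX ty≤t = subst (λ j → Covers j (suc k ∸ ty) a) ey (covers-rebase ty≤t (subst (t <_) (sym (m∸n+n≡m ty≤N)) t<N) e)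

      coversZY-first : t < ty → Covers (P z) (ty + (suc k ∸ tz)) a
      coversZY-first t<ty = subst (λ j → Covers j (ty + (suc k ∸ tz)) a) ez (covers-wrap (<⇒≤ tz<N) t<ty e)

      coversZY-third : tz ≤ t → Covers (P z) (ty + (suc k ∸ tz)) a
      coversZY-third tz≤t = subst (λ j → Covers j (ty + (suc k ∸ tz)) a) ez
        (covers-mono (m≤n+m (suc k ∸ tz) ty) (covers-rebase tz≤t (subst (t <_) (sym (m∸n+n≡m (<⇒≤ tz<N))) t<N) e))

    covering : ∀ {a a′ ta tb} → ta < suc k → tb < suc k → P x ⊕ ta ≡ a → P x ⊕ tb ≡ a′ → ArcCovering P a a′
    covering {a} {a′} {ta} {tb} ta<N tb<N ea eb = pick (region ta) (region tb)
      where
        viaXZ : ta < tz → tb < tz → ArcCovering P a a′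
        viaXZ p q = record
          { from = x ; to = z ; from≢to = x≢z ; arc = arcXZ ; covers = coversXZ ta<N ea p ; covers′ = coversXZ tb<N eb q }

        viaYX : ty ≤ ta → ty ≤ tb → ArcCovering P a a′
        viaYX p q = record
          { from = y ; to = x ; from≢to = x≢y ∘ sym ; arc = arcYX ; covers = coversYX ta<N ea p ; covers′ = coversYX tb<N eb q }

        viaZY : Covers (P z) (ty + (suc k ∸ tz)) a → Covers (P z) (ty + (suc k ∸ tz)) a′ → ArcCovering P a a′
        viaZY p q = record { from = z ; to = y ; from≢to = y≢z ∘ sym ; arc = arcZY ; covers = p ; covers′ = q }

        ty≤ : ∀ {t} → tz ≤ t → ty ≤ t
        ty≤ = ≤-trans (<⇒≤ ty<tz)

        <tz : ∀ {t} → t < ty → t < tz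
        <tz p = <-trans p ty<tz

        pick : Region ta → Region tb → ArcCovering P a a′
        pick (first p) (first q) = viaXZ (<tz p) (<tz q)
        pick (first p) (second _ q) = viaXZ (<tz p) q
        pick (first p) (third q) = viaZY (coversZY-first ta<N ea p) (coversZY-third tb<N eb q)
        pick (second _ p) (first q) = viaXZ p (<tz q)
        pick (second _ p) (second _ q) = viaXZ p q
        pick (second p _) (third q) = viaYX p (ty≤ q)
        pick (third p) (first q) = viaZY (coversZY-third ta<N ea p) (coversZY-first tb<N eb q)
        pick (third p) (second q _) = viaYX (ty≤ p) q
        pick (third p) (third q) = viaYX (ty≤ p) (ty≤ q)

  three-point-arc : (P : Fin 3 → Fin (suc k)) → Injective _≡_ _≡_ P → ∀ a a′ → ArcCovering P a a′
  three-point-arc P P-inj a a′ with ⊕-surjective (P zero) (P (suc zero)) | ⊕-surjective (P zero) (P (suc (suc zero)))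
  ... | t₁ , t₁<N , p₁ | t₂ , t₂<N , p₂ with ⊕-surjective (P zero) a | ⊕-surjective (P zero) a′ | <-cmp t₁ t₂
  ... | ta , ta<N , pa | tb , tb<N , pb | tri< t₁<t₂ _ _ =
    OrderedThreePoints.covering P (λ ()) (λ ()) (λ ()) (⊕-offset-nonzero ((λ ()) ∘ P-inj) p₁) t₁<t₂ t₂<N p₁ p₂ ta<N tb<N pa pb
  ... | _ | _ | tri≈ _ t₁≡t₂ _ with () ← P-inj (trans (sym p₁) (trans (cong (P zero ⊕_) t₁≡t₂) p₂))
  ... | ta , ta<N , pa | tb , tb<N , pb | tri> _ _ t₂<t₁ =
    OrderedThreePoints.covering P (λ ()) (λ ()) (λ ()) (⊕-offset-nonzero ((λ ()) ∘ P-inj) p₂) t₂<t₁ t₁<N p₂ p₁ ta<N tb<N pa pb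

-- Incidence and circuits

module Incidence (G : Graph) where

  joins-sym : ∀ {e x y} → Joins G e x y → Joins G e y x
  joins-sym (inj₁ p) = inj₂ p
  joins-sym (inj₂ p) = inj₁ p

  joins-incidentˡ : ∀ {e x y} → Joins G e x y → Incident G e x
  joins-incidentˡ (inj₁ (p , _)) = inj₁ p
  joins-incidentˡ (inj₂ (_ , q)) = inj₂ q

  joins-incidentʳ : ∀ {e x y} → Joins G e x y → Incident G e y
  joins-incidentʳ = joins-incidentˡ ∘ joins-sym

  incident-endpoint : ∀ {e x y w} → Joins G e x y → Incident G e w → w ≡ x ⊎ w ≡ y
  incident-endpoint (inj₁ (p , _)) (inj₁ r) = inj₁ (trans (sym r) p)
  incident-endpoint (inj₁ (_ , q)) (inj₂ r) = inj₂ (trans (sym r) q)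
  incident-endpoint (inj₂ (p , _)) (inj₁ r) = inj₂ (trans (sym r) p)
  incident-endpoint (inj₂ (_ , q)) (inj₂ r) = inj₁ (trans (sym r) q)

  joins-endpoints : ∀ {e x y x′ y′} → Joins G e x y → Joins G e x′ y′ → (x ≡ x′ × y ≡ y′) ⊎ (x ≡ y′ × y ≡ x′)
  joins-endpoints (inj₁ (p , q)) (inj₁ (p′ , q′)) = inj₁ (trans (sym p) p′ , trans (sym q) q′)
  joins-endpoints (inj₁ (p , q)) (inj₂ (p′ , q′)) = inj₂ (trans (sym p) p′ , trans (sym q) q′)
  joins-endpoints (inj₂ (p , q)) (inj₁ (p′ , q′)) = inj₂ (trans (sym q) q′ , trans (sym p) p′)
  joins-endpoints (inj₂ (p , q)) (inj₂ (p′ , q′)) = inj₁ (trans (sym q) q′ , trans (sym p) p′)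

  Separated : (E G → Set) → (E G → Set) → Set
  Separated R B = ∀ {e e′ w} → R e → B e′ → Incident G e w → Incident G e′ w → ⊥

  separated-sym : ∀ {R B} → Separated R B → Separated B R
  separated-sym sep b r b∋w r∋w = sep r b r∋w b∋w

  separated-disjoint : ∀ {R B e} → Separated R B → R e → B e → ⊥
  separated-disjoint sep r b = sep r b (inj₁ refl) (inj₁ refl)

module ClosedTrail (G : Graph) {n : ℕ} {v : Fin (3 + n) → V G} {c : Fin (3 + n) → E G}
  (v-inj : Injective _≡_ _≡_ v) (c-joins : ∀ i → Joins G (c i) (v i) (v (next i))) where
  open Incidence G

  private
    N = 3 + n

    0<N : 0 < N
    0<N = s≤s z≤n

    1<N : 1 < N
    1<N = s≤s (s≤s z≤n)

  c-injective : Injective _≡_ _≡_ c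
  c-injective {i} {j} e with joins-endpoints (c-joins i) (subst (λ e → Joins G e (v j) (v (next j))) (sym e) (c-joins j))
  ... | inj₁ (p , _) = v-inj p
  ... | inj₂ (p , q) with () ← ⊕-injective i 0<N (s≤s (s≤s (s≤s z≤n))) (trans (v-inj p) (sym (cong next (v-inj q))))

  side : ∀ {i w} → Incident G (c i) w → w ≡ v i ⊎ w ≡ v (next i)
  side = incident-endpoint (c-joins _)

  at-most-two-edges : ∀ {i j l w} → c i ≢ c j → c i ≢ c l → c j ≢ c l →
    Incident G (c i) w → Incident G (c j) w → Incident G (c l) w → ⊥
  at-most-two-edges {i} {j} {l} i≢j i≢l j≢l i∋w j∋w l∋w = pigeonhole (side i∋w) (side j∋w) (side l∋w)
    where
      pigeonhole : _ → _ → _ → ⊥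
      pigeonhole (inj₁ a) (inj₁ b) _ = i≢j (cong c (v-inj (trans (sym a) b)))
      pigeonhole (inj₂ a) (inj₂ b) _ = i≢j (cong c (next-injective (v-inj (trans (sym a) b))))
      pigeonhole (inj₁ a) (inj₂ b) (inj₁ d) = i≢l (cong c (v-inj (trans (sym a) d)))
      pigeonhole (inj₁ a) (inj₂ b) (inj₂ d) = j≢l (cong c (next-injective (v-inj (trans (sym b) d))))
      pigeonhole (inj₂ a) (inj₁ b) (inj₁ d) = j≢l (cong c (v-inj (trans (sym b) d)))
      pigeonhole (inj₂ a) (inj₁ b) (inj₂ d) = i≢l (cong c (next-injective (v-inj (trans (sym a) d))))

  other-edge-at : ∀ {i w} → Incident G (c i) w → ∃ λ j → c j ≢ c i × Incident G (c j) w
  other-edge-at {i} i∋w with side i∋w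
  ... | inj₁ refl = i ⊕ (2 + n) , (λ e → contradiction (⊕-injective i ≤-refl 0<N (c-injective e)) λ ()) ,
    subst (Incident G (c (i ⊕ (2 + n))) ∘ v) (⊕-periodic i) (joins-incidentʳ (c-joins _))
  ... | inj₂ refl = next i , (λ e → contradiction (⊕-injective i 1<N 0<N (c-injective e)) λ ()) , joins-incidentˡ (c-joins (next i))

  adjacent-edges : ∀ {i j w} → c i ≢ c j → Incident G (c i) w → Incident G (c j) w → j ≡ next i ⊎ i ≡ next j
  adjacent-edges i≢j i∋w j∋w with side i∋w | side j∋w
  ... | inj₁ a | inj₁ b = contradiction (cong c (v-inj (trans (sym a) b))) i≢j
  ... | inj₂ a | inj₂ b = contradiction (cong c (next-injective (v-inj (trans (sym a) b)))) i≢j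
  ... | inj₁ a | inj₂ b = inj₂ (v-inj (trans (sym a) b))
  ... | inj₂ a | inj₁ b = inj₁ (v-inj (trans (sym b) a))

  offset-beyond-next : ∀ p j → c j ≢ c p → c j ≢ c (next p) → ∃ λ t → 2 ≤ t × t < N × p ⊕ t ≡ j
  offset-beyond-next p j j≢p j≢p′ with ⊕-surjective p j
  ... | zero , _ , refl = contradiction refl j≢p
  ... | suc zero , _ , refl = contradiction refl j≢p′
  ... | suc (suc t) , t<N , e = suc (suc t) , s≤s (s≤s z≤n) , t<N , e

  beyond-next : ∀ p {t} → 2 ≤ t → t < N → c (p ⊕ t) ≢ c p × c (p ⊕ t) ≢ c (next p)
  beyond-next p {t} 2≤t t<N =
    (λ e → <⇒≢ (≤-trans (s≤s z≤n) 2≤t) (sym (⊕-injective p t<N 0<N (c-injective e)))) ,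
    (λ e → <⇒≢ 2≤t (sym (⊕-injective p t<N 1<N (c-injective e))))

  coloured-beyond : ∀ {S S′ : E G → Set} p → (∀ {l} → c l ≢ c p → c l ≢ c (next p) → S (c l) ⊎ S′ (c l)) →
    ∀ {t} → 2 ≤ t → t < N → S (c (p ⊕ t)) ⊎ S′ (c (p ⊕ t))
  coloured-beyond p coloured 2≤t t<N = uncurry coloured (beyond-next p 2≤t t<N)

  module _ {S S′ : E G → Set} (sep : Separated S S′) (p : Fin N)
    (coloured : ∀ {t} → 2 ≤ t → t < N → S (c (p ⊕ t)) ⊎ S′ (c (p ⊕ t))) where

    colour-spreads : ∀ d {t} → 2 ≤ t → d + t < N → S (c (p ⊕ t)) → S (c (p ⊕ (d + t)))
    colour-spreads zero _ _ s = s
    colour-spreads (suc d) {t} 2≤t d+t<N s with coloured (≤-trans 2≤t (m≤n+m t (suc d))) d+t<N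
    ... | inj₁ s′ = s′
    ... | inj₂ s̄ = ⊥-elim (sep (colour-spreads d 2≤t (<-trans (n<1+n _) d+t<N) s) s̄
                                 (joins-incidentʳ (c-joins _)) (joins-incidentˡ (c-joins _)))

    colour-reaches : ∀ {t t′} → 2 ≤ t → t ≤ t′ → t′ < N → S (c (p ⊕ t)) → S (c (p ⊕ t′))
    colour-reaches {t} {t′} 2≤t t≤t′ t′<N s = subst (S ∘ c ∘ (p ⊕_)) (m∸n+n≡m t≤t′)
      (colour-spreads (t′ ∸ t) 2≤t (subst (_< N) (sym (m∸n+n≡m t≤t′)) t′<N) s)

  monochromatic-after : ∀ {R B} → Separated R B → ∀ p → (∀ {l} → c l ≢ c p → c l ≢ c (next p) → R (c l) ⊎ B (c l)) →
    ∀ {i j} → c i ≢ c p → c i ≢ c (next p) → R (c i) → c j ≢ c p → c j ≢ c (next p) → B (c j) → ⊥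
  monochromatic-after {R} {B} sep p coloured i≢p i≢p′ r j≢p j≢p′ b
    with offset-beyond-next p _ i≢p i≢p′ | offset-beyond-next p _ j≢p j≢p′
  ... | tr , 2≤tr , tr<N , refl | tb , 2≤tb , tb<N , refl with ≤-total tr tb
  ... | inj₁ tr≤tb = separated-disjoint sep (colour-reaches sep p (coloured-beyond {R} {B} p coloured) 2≤tr tr≤tb tb<N r) b
  ... | inj₂ tb≤tr = separated-disjoint sep r
    (colour-reaches (separated-sym sep) p (coloured-beyond {B} {R} p (λ l≢p l≢p′ → swap (coloured l≢p l≢p′))) 2≤tb tb≤tr tr<N b)

  monochromatic-beside : ∀ {R B} → Separated R B → ∀ {p q} → q ≡ next p ⊎ p ≡ next q →
    (∀ {l} → c l ≢ c p → c l ≢ c q → R (c l) ⊎ B (c l)) →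
    ∀ {i j} → c i ≢ c p → c i ≢ c q → R (c i) → c j ≢ c p → c j ≢ c q → B (c j) → ⊥
  monochromatic-beside sep (inj₁ refl) coloured i≢p i≢q r j≢p j≢q b = monochromatic-after sep _ coloured i≢p i≢q r j≢p j≢q b
  monochromatic-beside sep (inj₂ refl) coloured i≢p i≢q r j≢p j≢q b = monochromatic-after sep _ (flip coloured) i≢q i≢p r j≢q j≢p b

module Circuit (G : Graph) where
  open Incidence G

  degree≤2 : ∀ {C} → IsCircuit G C → ∀ {x y z w} → C x → C y → C z → x ≢ y → x ≢ z → y ≢ z →
    Incident G x w → Incident G y w → Incident G z w → ⊥
  degree≤2 (_ , _ , _ , v-inj , c-joins , enum , _) Cx Cy Cz with enum _ Cx | enum _ Cy | enum _ Cz
  ... | _ , refl | _ , refl | _ , refl = ClosedTrail.at-most-two-edges G v-inj c-joins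

  other-edge : ∀ {C} → IsCircuit G C → ∀ {x w} → C x → Incident G x w → ∃ λ y → C y × y ≢ x × Incident G y w
  other-edge (_ , _ , c , v-inj , c-joins , enum , mem) Cx x∋w with enum _ Cx
  ... | i , refl with ClosedTrail.other-edge-at G v-inj c-joins x∋w
  ... | j , j≢i , j∋w = c j , mem j , j≢i , j∋w

  path-monochromatic : ∀ {C} → IsCircuit G C → ∀ {R B} → Separated R B →
    ∀ {x y} → C x → C y → x ≢ y → CommonVertex G x y → (∀ {e} → C e → e ≢ x → e ≢ y → R e ⊎ B e) →
    ∀ {r b} → C r → R r → r ≢ x → r ≢ y → C b → B b → b ≢ x → b ≢ y → ⊥
  path-monochromatic (_ , _ , _ , v-inj , c-joins , enum , mem) sep Cx Cy x≢y (w , x∋w , y∋w) coloured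
    Cr r r≢x r≢y Cb b b≢x b≢y with enum _ Cx | enum _ Cy | enum _ Cr | enum _ Cb
  ... | _ , refl | _ , refl | _ , refl | _ , refl =
    monochromatic-beside sep (adjacent-edges x≢y x∋w y∋w) (coloured (mem _)) r≢x r≢y r b≢x b≢y b
    where open ClosedTrail G v-inj c-joins

  circuit-resp : ∀ {C C′} → (∀ {e} → C e → C′ e) → (∀ {e} → C′ e → C e) → IsCircuit G C → IsCircuit G C′
  circuit-resp to from (n , v , c , v-inj , c-joins , enum , mem) = n , v , c , v-inj , c-joins , (λ e → enum e ∘ from) , to ∘ mem

-- Walks

unique-reverse : ∀ {A : Set} {xs : List A} → Unique xs → Unique (reverse xs)
unique-reverse {xs = []} u = u
unique-reverse {xs = x ∷ xs} (x∉xs ∷ u) = subst Unique (sym (unfold-reverse x xs))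
  (Unique.++⁺ (unique-reverse u) (All.[] ∷ []) λ { (x∈ , here refl) → All.lookup x∉xs (Any.reverse⁻ x∈) refl })

module Walks (G : Graph) where
  open Incidence G

  data Walk : V G → V G → Set where
    [] : ∀ {x} → Walk x x
    step : ∀ {x y z} (e : E G) → Joins G e x y → Walk y z → Walk x z

  departures : ∀ {x y} → Walk x y → List (V G)
  departures [] = []
  departures (step {x} _ _ w) = x ∷ departures w

  visited : ∀ {x y} → Walk x y → List (V G)
  visited {y = y} w = departures w ∷ʳ y

  traversed : ∀ {x y} → Walk x y → List (E G)
  traversed [] = []
  traversed (step e _ w) = e ∷ traversed w

  infixr 5 _++ʷ_

  _++ʷ_ : ∀ {x y z} → Walk x y → Walk y z → Walk x z
  [] ++ʷ w′ = w′
  step e j w ++ʷ w′ = step e j (w ++ʷ w′)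

  reverseʷ : ∀ {x y} → Walk x y → Walk y x
  reverseʷ [] = []
  reverseʷ (step e j w) = reverseʷ w ++ʷ step e (joins-sym j) []

  castʷ : ∀ {x y x′ y′} → x ≡ x′ → y ≡ y′ → Walk x y → Walk x′ y′
  castʷ refl refl w = w

  departures-castʷ : ∀ {x y x′ y′} (p : x ≡ x′) (q : y ≡ y′) (w : Walk x y) → departures (castʷ p q w) ≡ departures w
  departures-castʷ refl refl w = refl

  walk-nonempty : ∀ {x y} → x ≢ y → (w : Walk x y) → 0 < length (traversed w)
  walk-nonempty x≢y [] = contradiction refl x≢y
  walk-nonempty x≢y (step _ _ _) = s≤s z≤n

  departures-++ : ∀ {x y z} (w : Walk x y) (w′ : Walk y z) → departures (w ++ʷ w′) ≡ departures w ++ departures w′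
  departures-++ [] w′ = refl
  departures-++ (step _ _ w) w′ = cong (_ ∷_) (departures-++ w w′)

  traversed-++ : ∀ {x y z} (w : Walk x y) (w′ : Walk y z) → traversed (w ++ʷ w′) ≡ traversed w ++ traversed w′
  traversed-++ [] w′ = refl
  traversed-++ (step _ _ w) w′ = cong (_ ∷_) (traversed-++ w w′)

  traversed-reverse : ∀ {x y} (w : Walk x y) → traversed (reverseʷ w) ≡ reverse (traversed w)
  traversed-reverse [] = refl
  traversed-reverse (step e j w) = begin
    traversed (reverseʷ w ++ʷ step e (joins-sym j) [])  ≡⟨ traversed-++ (reverseʷ w) _ ⟩
    traversed (reverseʷ w) ++ [ e ]                       ≡⟨ cong (_++ [ e ]) (traversed-reverse w) ⟩
    reverse (traversed w) ++ [ e ]                        ≡⟨ sym (unfold-reverse e (traversed w)) ⟩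
    reverse (e ∷ traversed w)                             ∎
    where open ≡-Reasoning

  visited-reverse : ∀ {x y} (w : Walk x y) → visited (reverseʷ w) ≡ reverse (visited w)
  visited-reverse [] = refl
  visited-reverse {x} {z} (step {y = y} e j w) = begin
    departures (reverseʷ w ++ʷ step e (joins-sym j) []) ∷ʳ x  ≡⟨ cong (_∷ʳ x) (departures-++ (reverseʷ w) _) ⟩
    (departures (reverseʷ w) ++ [ y ]) ∷ʳ x                    ≡⟨ cong (_∷ʳ x) (visited-reverse w) ⟩
    reverse (departures w ∷ʳ z) ∷ʳ x                           ≡⟨ sym (unfold-reverse x (departures w ∷ʳ z)) ⟩
    reverse (x ∷ departures w ∷ʳ z)                            ∎
    where open ≡-Reasoning

  source target : ∀ {x y} (w : Walk x y) → Fin (length (traversed w)) → V G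
  source (step {x} _ _ _) zero = x
  source (step _ _ w) (suc i) = source w i
  target (step {y = y} _ _ _) zero = y
  target (step _ _ w) (suc i) = target w i

  edgeAt : ∀ {x y} (w : Walk x y) → Fin (length (traversed w)) → E G
  edgeAt (step e _ _) zero = e
  edgeAt (step _ _ w) (suc i) = edgeAt w i

  edgeAt-joins : ∀ {x y} (w : Walk x y) i → Joins G (edgeAt w i) (source w i) (target w i)
  edgeAt-joins (step _ j _) zero = j
  edgeAt-joins (step _ _ w) (suc i) = edgeAt-joins w i

  target-last : ∀ {x y z e} (j : Joins G e x z) (w : Walk z y) → target (step e j w) (fromℕ (length (traversed w))) ≡ y
  target-last j [] = refl
  target-last j (step _ j′ w) = target-last j′ w

  target-inject₁ : ∀ {x y z e} (j : Joins G e x z) (w : Walk z y) i → target (step e j w) (inject₁ i) ≡ source w i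
  target-inject₁ j (step _ _ _) zero = refl
  target-inject₁ j (step _ j′ w) (suc i) = target-inject₁ j′ w i

  source∈departures : ∀ {x y} (w : Walk x y) i → source w i ∈ departures w
  source∈departures (step _ _ _) zero = here refl
  source∈departures (step _ _ w) (suc i) = there (source∈departures w i)

  edgeAt∈traversed : ∀ {x y} (w : Walk x y) i → edgeAt w i ∈ traversed w
  edgeAt∈traversed (step _ _ _) zero = here refl
  edgeAt∈traversed (step _ _ w) (suc i) = there (edgeAt∈traversed w i)

  traversed-edgeAt : ∀ {x y} (w : Walk x y) {e} → e ∈ traversed w → ∃ λ i → edgeAt w i ≡ e
  traversed-edgeAt (step _ _ _) (here refl) = zero , refl
  traversed-edgeAt (step _ _ w) (there e∈) with traversed-edgeAt w e∈
  ... | i , refl = suc i , refl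

  source-injective : ∀ {x y} (w : Walk x y) → Unique (departures w) → ∀ {i i′} → source w i ≡ source w i′ → i ≡ i′
  source-injective (step _ _ _) _ {zero} {zero} _ = refl
  source-injective (step _ _ w) (x∉ ∷ _) {zero} {suc i′} e = ⊥-elim (All.lookup x∉ (source∈departures w i′) e)
  source-injective (step _ _ w) (x∉ ∷ _) {suc i} {zero} e = ⊥-elim (All.lookup x∉ (source∈departures w i) (sym e))
  source-injective (step _ _ w) (_ ∷ u) {suc i} {suc i′} e = cong suc (source-injective w u e)

  enumerated-circuit : ∀ {C} k → 2 ≤ k → (v : Fin (suc k) → V G) (c : Fin (suc k) → E G) →
    Injective _≡_ _≡_ v → (∀ i → Joins G (c i) (v i) (v (next i))) →
    (∀ e → C e → ∃ λ i → c i ≡ e) → (∀ i → C (c i)) → IsCircuit G C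
  enumerated-circuit (suc zero) (s≤s ()) _ _ _ _ _ _
  enumerated-circuit (suc (suc n)) _ v c v-inj c-joins enum mem = n , v , c , v-inj , c-joins , enum , mem

  closed-walk-circuit : ∀ {x} (w : Walk x x) → 3 ≤ length (traversed w) → Unique (departures w) →
    IsCircuit G (_∈ traversed w)
  closed-walk-circuit w@(step e j w′) (s≤s 2≤k) u =
    enumerated-circuit _ 2≤k (source w) (edgeAt w) (source-injective w u) edgeAt-joins-next (λ _ → traversed-edgeAt w) (edgeAt∈traversed w)
    where
      edgeAt-joins-next : ∀ i → Joins G (edgeAt w i) (source w i) (source w (next i))
      edgeAt-joins-next i with fromℕ-or-inject₁ i
      ... | inj₁ refl =
        subst (Joins G _ _) (trans (target-last j w′) (cong (source w) (sym (next-fromℕ _)))) (edgeAt-joins w (fromℕ _))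
      ... | inj₂ (i′ , refl) =
        subst (Joins G _ _) (trans (target-inject₁ j w′ i′) (cong (source w) (sym (next-inject₁ i′)))) (edgeAt-joins w (inject₁ i′))

  trail : (f : ℕ → V G) (g : ℕ → E G) → (∀ t → Joins G (g t) (f t) (f (suc t))) → ∀ d → Walk (f 0) (f d)
  trail f g g-joins zero = []
  trail f g g-joins (suc d) = step (g 0) (g-joins 0) (trail (f ∘ suc) (g ∘ suc) (g-joins ∘ suc) d)

  departures-trail : ∀ f g g-joins d → departures (trail f g g-joins d) ≡ applyUpTo f d
  departures-trail f g g-joins zero = refl
  departures-trail f g g-joins (suc d) = cong (f 0 ∷_) (departures-trail (f ∘ suc) (g ∘ suc) (g-joins ∘ suc) d)

  visited-trail : ∀ f g g-joins d → visited (trail f g g-joins d) ≡ applyUpTo f (suc d)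
  visited-trail f g g-joins d = trans (cong (_∷ʳ f d) (departures-trail f g g-joins d)) (applyUpTo-∷ʳ f d)

  traversed-trail : ∀ f g g-joins d → traversed (trail f g g-joins d) ≡ applyUpTo g d
  traversed-trail f g g-joins zero = refl
  traversed-trail f g g-joins (suc d) = cong (g 0 ∷_) (traversed-trail (f ∘ suc) (g ∘ suc) (g-joins ∘ suc) d)

  path : ∀ {k} (p : Fin (suc k) → V G) (c : Fin k → E G) → (∀ i → Joins G (c i) (p (inject₁ i)) (p (suc i))) →
    Walk (p zero) (p (fromℕ k))
  path {zero} p c c-joins = []
  path {suc k} p c c-joins = step (c zero) (c-joins zero) (path (p ∘ suc) (c ∘ suc) (c-joins ∘ suc))

  departures-path : ∀ {k} p c c-joins → departures (path {k} p c c-joins) ≡ tabulate (p ∘ inject₁)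
  departures-path {zero} p c c-joins = refl
  departures-path {suc k} p c c-joins = cong (p zero ∷_) (departures-path (p ∘ suc) (c ∘ suc) (c-joins ∘ suc))

  record Along (On : V G → Set) (Edge : E G → Set) {x y} (w : Walk x y) : Set where
    field
      unique : Unique (visited w)
      on : ∀ {v} → v ∈ visited w → On v
      edge : ∀ {e} → e ∈ traversed w → Edge e

  along-reverse : ∀ {On Edge x y} {w : Walk x y} → Along On Edge w → Along On Edge (reverseʷ w)
  along-reverse {w = w} along = record
    { unique = subst Unique (sym (visited-reverse w)) (unique-reverse unique)
    ; on = on ∘ Any.reverse⁻ ∘ subst (_ ∈_) (visited-reverse w)
    ; edge = edge ∘ Any.reverse⁻ ∘ subst (_ ∈_) (traversed-reverse w)
    }
    where open Along along

  module CycleArcs {k} {v : Fin (suc k) → V G} {c : Fin (suc k) → E G}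
    (v-inj : Injective _≡_ _≡_ v) (c-joins : ∀ i → Joins G (c i) (v i) (v (next i))) where

    OnCycle : V G → Set
    OnCycle x = ∃ λ i → v i ≡ x

    EdgeOfCycle : E G → Set
    EdgeOfCycle e = ∃ λ i → c i ≡ e

    arcWalk : ∀ {i j} → Arc i j → Walk (v i) (v j)
    arcWalk {i} record { steps = d ; ends = refl } = trail (v ∘ (i ⊕_)) (c ∘ (i ⊕_)) (c-joins ∘ (i ⊕_)) d

    arcWalk-along : ∀ {i j} (r : Arc i j) → Along OnCycle EdgeOfCycle (arcWalk r)
    arcWalk-along {i} record { steps = d ; steps<N = d<N ; ends = refl } = record
      { unique = subst Unique (sym (visited-trail f g g-joins d))
          (Unique.applyUpTo⁺₁ f (suc d) λ s<t t<1+d → <⇒≢ s<t ∘ ⊕-injective i (<-trans s<t (t<N t<1+d)) (t<N t<1+d) ∘ v-inj)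
      ; on = λ x∈ → let (u , _ , x≡) = ∈-applyUpTo⁻ f (subst (_ ∈_) (visited-trail f g g-joins d) x∈) in i ⊕ u , sym x≡
      ; edge = λ e∈ → let (u , _ , e≡) = ∈-applyUpTo⁻ g (subst (_ ∈_) (traversed-trail f g g-joins d) e∈) in i ⊕ u , sym e≡
      }
      where
        f = v ∘ (i ⊕_)
        g = c ∘ (i ⊕_)
        g-joins = c-joins ∘ (i ⊕_)
        t<N : ∀ {t} → t < suc d → t < suc k
        t<N t<1+d = ≤-<-trans (s≤s⁻¹ t<1+d) d<N

    arcWalk-covers : ∀ {i j a} (r : Arc i j) → Covers i (Arc.steps r) a → c a ∈ traversed (arcWalk r)
    arcWalk-covers {i} record { steps = d ; ends = refl } (u , u<d , refl) =
      subst (_ ∈_) (sym (traversed-trail (v ∘ (i ⊕_)) (c ∘ (i ⊕_)) (c-joins ∘ (i ⊕_)) d)) (∈-applyUpTo⁺ (c ∘ (i ⊕_)) u<d)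

-- Graphs of type X

triple : {A : Set} → A → A → A → Fin 3 → A
triple a b c zero = a
triple a b c (suc zero) = b
triple a b c (suc (suc zero)) = c

triple-injective : ∀ {A : Set} {a b c : A} → a ≢ b → a ≢ c → b ≢ c → Injective _≡_ _≡_ (triple a b c)
triple-injective a≢b a≢c b≢c {zero} {zero} _ = refl
triple-injective a≢b a≢c b≢c {zero} {suc zero} e = contradiction e a≢b
triple-injective a≢b a≢c b≢c {zero} {suc (suc zero)} e = contradiction e a≢c
triple-injective a≢b a≢c b≢c {suc zero} {zero} e = contradiction (sym e) a≢b
triple-injective a≢b a≢c b≢c {suc zero} {suc zero} _ = refl
triple-injective a≢b a≢c b≢c {suc zero} {suc (suc zero)} e = contradiction e b≢c
triple-injective a≢b a≢c b≢c {suc (suc zero)} {zero} e = contradiction (sym e) a≢c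
triple-injective a≢b a≢c b≢c {suc (suc zero)} {suc zero} e = contradiction (sym e) b≢c
triple-injective a≢b a≢c b≢c {suc (suc zero)} {suc (suc zero)} _ = refl

module TypeXGraph (G : Graph) (X : TypeX G) where
  open Incidence G
  open Walks G
  open Circuit G
  private module T = TypeX X

  module A = CycleArcs T.α-inj T.cA-joins
  module B = CycleArcs T.β-inj T.cB-joins

  Inner : V G → Set
  Inner x = ∃ λ (k : Fin T.m) → T.π (suc (inject₁ k)) ≡ x

  onA-onB : ∀ {x} → A.OnCycle x → B.OnCycle x → ⊥
  onA-onB (i , refl) (j , e) = T.AB-disjoint i j (sym e)

  onA-inner : ∀ {x} → A.OnCycle x → Inner x → ⊥
  onA-inner (i , refl) (k , e) = T.π-innerA k i e

  onB-inner : ∀ {x} → B.OnCycle x → Inner x → ⊥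
  onB-inner (j , refl) (k , e) = T.π-innerB k j e

  edgeA-edgeB : ∀ {e} → A.EdgeOfCycle e → B.EdgeOfCycle e → ⊥
  edgeA-edgeB (i , refl) (j , e) = [ T.AB-disjoint i j ∘ proj₁ , T.AB-disjoint i (next j) ∘ proj₁ ]′
    (joins-endpoints (T.cA-joins i) (subst (λ e → Joins G e (T.β j) (T.β (next j))) e (T.cB-joins j)))

  connecting-not-edgeA : ∀ {e i j} → Joins G e (T.α i) (T.β j) → ¬ A.EdgeOfCycle e
  connecting-not-edgeA {i = i} {j} e-joins (i′ , refl) =
    [ T.AB-disjoint (next i′) j ∘ sym ∘ proj₂ , T.AB-disjoint i′ j ∘ sym ∘ proj₂ ]′ (joins-endpoints e-joins (T.cA-joins i′))

  connecting-not-edgeB : ∀ {e i j} → Joins G e (T.α i) (T.β j) → ¬ B.EdgeOfCycle e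
  connecting-not-edgeB {i = i} {j} e-joins (j′ , refl) =
    [ T.AB-disjoint i j′ ∘ proj₁ , T.AB-disjoint i (next j′) ∘ proj₁ ]′ (joins-endpoints e-joins (T.cB-joins j′))

  e₁≢e₂ : T.e₁ ≢ T.e₂
  e₁≢e₂ e = [ T.i₁≢i₂ ∘ T.α-inj ∘ proj₁ , T.AB-disjoint T.i₁ T.j₂ ∘ proj₁ ]′
    (joins-endpoints T.e₁-joins (subst (λ e → Joins G e (T.α T.i₂) (T.β T.j₂)) (sym e) T.e₂-joins))

  aPoint : Fin 3 → Fin (3 + T.pA)
  aPoint = triple T.i₁ T.i₂ T.i₃

  bPoint : Fin 3 → Fin (3 + T.pB)
  bPoint = triple T.j₁ T.j₂ T.j₃

  record Connector (i : Fin (3 + T.pA)) (j : Fin (3 + T.pB)) : Set where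
    field
      walk : Walk (T.α i) (T.β j)
      inner : List (V G)
      departures-walk : departures walk ≡ T.α i ∷ inner
      inner-inner : ∀ {x} → x ∈ inner → Inner x
      inner-unique : Unique inner

    visited-walk : visited walk ≡ T.α i ∷ inner ∷ʳ T.β j
    visited-walk = cong (_∷ʳ T.β j) departures-walk

    departures-reverse : departures (reverseʷ walk) ≡ T.β j ∷ reverse inner
    departures-reverse = ∷ʳ-injectiveˡ _ _ (begin
      visited (reverseʷ walk)              ≡⟨ visited-reverse walk ⟩
      reverse (visited walk)               ≡⟨ cong reverse visited-walk ⟩
      reverse (T.α i ∷ inner ∷ʳ T.β j)     ≡⟨ reverse-++ (T.α i ∷ inner) [ T.β j ] ⟩
      T.β j ∷ reverse (T.α i ∷ inner)      ≡⟨ cong (T.β j ∷_) (unfold-reverse (T.α i) inner) ⟩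
      T.β j ∷ reverse inner ∷ʳ T.α i       ∎)
      where open ≡-Reasoning

  open Connector

  edge-connector : ∀ {e i j} → Joins G e (T.α i) (T.β j) → Connector i j
  edge-connector e-joins = record
    { walk = step _ e-joins [] ; inner = [] ; departures-walk = refl ; inner-inner = λ () ; inner-unique = [] }

  path-connector : Connector T.i₃ T.j₃
  path-connector = record
    { walk = castʷ T.π-start T.π-end (path T.π T.cP T.cP-joins)
    ; inner = tabulate (T.π ∘ suc ∘ inject₁)
    ; departures-walk = trans (departures-castʷ T.π-start T.π-end _) (trans (departures-path T.π T.cP T.cP-joins) (cong (_∷ _) T.π-start))
    ; inner-inner = λ x∈ → let (k , x≡) = ∈-tabulate⁻ x∈ in k , sym x≡
    ; inner-unique = Unique.tabulate⁺ (inject₁-injective ∘ Fin-suc-injective ∘ T.π-inj)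
    }

  connector : ∀ x → Connector (aPoint x) (bPoint x)
  connector zero = edge-connector T.e₁-joins
  connector (suc zero) = edge-connector T.e₂-joins
  connector (suc (suc zero)) = path-connector

  connector-inner-disjoint : ∀ {x y v} → x ≢ y → v ∈ inner (connector x) → v ∈ inner (connector y) → ⊥
  connector-inner-disjoint {zero} _ ()
  connector-inner-disjoint {suc zero} _ ()
  connector-inner-disjoint {suc (suc zero)} {zero} _ _ ()
  connector-inner-disjoint {suc (suc zero)} {suc zero} _ _ ()
  connector-inner-disjoint {suc (suc zero)} {suc (suc zero)} x≢y = contradiction refl x≢y

  module ThetaWalk {i i′ j j′} (K : Connector i j) (K′ : Connector i′ j′)
    (Aw : Walk (T.α i) (T.α i′)) (Bw : Walk (T.β j′) (T.β j)) where

    closed : Walk (T.α i) (T.α i)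
    closed = Aw ++ʷ walk K′ ++ʷ Bw ++ʷ reverseʷ (walk K)

    traversed-closed : traversed closed ≡ traversed Aw ++ traversed (walk K′) ++ traversed Bw ++ reverse (traversed (walk K))
    traversed-closed = begin
      traversed closed
        ≡⟨ traversed-++ Aw _ ⟩
      traversed Aw ++ traversed (walk K′ ++ʷ Bw ++ʷ reverseʷ (walk K))
        ≡⟨ cong (traversed Aw ++_) (traversed-++ (walk K′) _) ⟩
      traversed Aw ++ traversed (walk K′) ++ traversed (Bw ++ʷ reverseʷ (walk K))
        ≡⟨ cong (λ es → traversed Aw ++ traversed (walk K′) ++ es) (traversed-++ Bw _) ⟩
      traversed Aw ++ traversed (walk K′) ++ traversed Bw ++ traversed (reverseʷ (walk K))
        ≡⟨ cong (λ es → traversed Aw ++ traversed (walk K′) ++ traversed Bw ++ es) (traversed-reverse (walk K)) ⟩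
      traversed Aw ++ traversed (walk K′) ++ traversed Bw ++ reverse (traversed (walk K)) ∎
      where open ≡-Reasoning

    departures-closed : departures closed ≡ visited Aw ++ inner K′ ++ visited Bw ++ reverse (inner K)
    departures-closed = begin
      departures closed
        ≡⟨ departures-++ Aw _ ⟩
      departures Aw ++ departures (walk K′ ++ʷ Bw ++ʷ reverseʷ (walk K))
        ≡⟨ cong (departures Aw ++_) (departures-++ (walk K′) _) ⟩
      departures Aw ++ departures (walk K′) ++ departures (Bw ++ʷ reverseʷ (walk K))
        ≡⟨ cong (λ vs → departures Aw ++ departures (walk K′) ++ vs) (departures-++ Bw _) ⟩
      departures Aw ++ departures (walk K′) ++ departures Bw ++ departures (reverseʷ (walk K))
        ≡⟨ cong₂ (λ vs us → departures Aw ++ vs ++ departures Bw ++ us) (departures-walk K′) (departures-reverse K) ⟩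
      departures Aw ++ (T.α i′ ∷ inner K′) ++ departures Bw ++ (T.β j ∷ reverse (inner K))
        ≡⟨ cong (λ vs → departures Aw ++ T.α i′ ∷ inner K′ ++ vs) (sym (++-assoc (departures Bw) [ T.β j ] _)) ⟩
      departures Aw ++ (T.α i′ ∷ inner K′ ++ visited Bw ++ reverse (inner K))
        ≡⟨ sym (++-assoc (departures Aw) [ T.α i′ ] _) ⟩
      visited Aw ++ inner K′ ++ visited Bw ++ reverse (inner K) ∎
      where open ≡-Reasoning

    length-closed : length (traversed closed) ≡
      length (traversed Aw) + (length (traversed (walk K′)) + (length (traversed Bw) + length (traversed (walk K))))
    length-closed = begin
      length (traversed closed)
        ≡⟨ cong length traversed-closed ⟩
      length (traversed Aw ++ traversed (walk K′) ++ traversed Bw ++ reverse (traversed (walk K)))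
        ≡⟨ length-++ (traversed Aw) ⟩
      length (traversed Aw) + length (traversed (walk K′) ++ traversed Bw ++ reverse (traversed (walk K)))
        ≡⟨ cong (length (traversed Aw) +_) (length-++ (traversed (walk K′))) ⟩
      length (traversed Aw) + (length (traversed (walk K′)) + length (traversed Bw ++ reverse (traversed (walk K))))
        ≡⟨ cong (λ n → length (traversed Aw) + (length (traversed (walk K′)) + n))
                (trans (length-++ (traversed Bw)) (cong (length (traversed Bw) +_) (length-reverse (traversed (walk K))))) ⟩
      length (traversed Aw) + (length (traversed (walk K′)) + (length (traversed Bw) + length (traversed (walk K)))) ∎
      where open ≡-Reasoning

  ThetaEdge : ∀ {i i′ j j′} → Walk (T.α i) (T.α i′) → Walk (T.β j′) (T.β j) → Connector i j → Connector i′ j′ →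
    EdgeSet G
  ThetaEdge Aw Bw K K′ e = e ∈ traversed Aw ⊎ e ∈ traversed Bw ⊎ e ∈ traversed (walk K) ⊎ e ∈ traversed (walk K′)

  theta-circuit : ∀ {i i′ j j′} (K : Connector i j) (K′ : Connector i′ j′) →
    (∀ {v} → v ∈ inner K → v ∈ inner K′ → ⊥) →
    (Aw : Walk (T.α i) (T.α i′)) → Along A.OnCycle A.EdgeOfCycle Aw → 0 < length (traversed Aw) →
    (Bw : Walk (T.β j′) (T.β j)) → Along B.OnCycle B.EdgeOfCycle Bw →
    IsCircuit G (ThetaEdge Aw Bw K K′)
  theta-circuit {i} {i′} {j} {j′} K K′ inner-disjoint Aw Aw-along Aw-nonempty Bw Bw-along =
    circuit-resp to from (closed-walk-circuit closed long unique)
    where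
      open ThetaWalk K K′ Aw Bw
      module Aw = Along Aw-along
      module Bw = Along Bw-along

      B|K : Disjoint (visited Bw) (reverse (inner K))
      B|K (v∈Bw , v∈K) = onB-inner (Bw.on v∈Bw) (inner-inner K (Any.reverse⁻ v∈K))

      K′|BK : Disjoint (inner K′) (visited Bw ++ reverse (inner K))
      K′|BK (v∈K′ , v∈BK) =
        [ (λ v∈Bw → onB-inner (Bw.on v∈Bw) (inner-inner K′ v∈K′)) , (λ v∈K → inner-disjoint (Any.reverse⁻ v∈K) v∈K′) ]′
          (∈-++⁻ (visited Bw) v∈BK)

      A|K′BK : Disjoint (visited Aw) (inner K′ ++ visited Bw ++ reverse (inner K))
      A|K′BK (v∈Aw , v∈K′BK) =
        [ onA-inner onA ∘ inner-inner K′
        , [ onA-onB onA ∘ Bw.on , onA-inner onA ∘ inner-inner K ∘ Any.reverse⁻ ]′ ∘ ∈-++⁻ (visited Bw)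
        ]′ (∈-++⁻ (inner K′) v∈K′BK)
        where onA = Aw.on v∈Aw

      unique : Unique (departures closed)
      unique = subst Unique (sym departures-closed)
        (Unique.++⁺ Aw.unique (Unique.++⁺ (inner-unique K′) (Unique.++⁺ Bw.unique (unique-reverse (inner-unique K)) B|K) K′|BK) A|K′BK)

      nonempty : ∀ {i j} (K : Connector i j) → 0 < length (traversed (walk K))
      nonempty {i} {j} K = walk-nonempty (T.AB-disjoint i j) (walk K)

      long : 3 ≤ length (traversed closed)
      long = subst (3 ≤_) (sym length-closed) (+-mono-≤ Aw-nonempty (+-mono-≤ (nonempty K′) (≤-trans (nonempty K) (m≤n+m _ _))))

      to : ∀ {e} → e ∈ traversed closed → ThetaEdge Aw Bw K K′ e
      to e∈ =
        [ inj₁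
        , [ inj₂ ∘ inj₂ ∘ inj₂
          , [ inj₂ ∘ inj₁ , inj₂ ∘ inj₂ ∘ inj₁ ∘ Any.reverse⁻ ]′ ∘ ∈-++⁻ (traversed Bw)
          ]′ ∘ ∈-++⁻ (traversed (walk K′))
        ]′ (∈-++⁻ (traversed Aw) (subst (_ ∈_) traversed-closed e∈))

      from : ∀ {e} → ThetaEdge Aw Bw K K′ e → e ∈ traversed closed
      from = subst (_ ∈_) (sym traversed-closed) ∘
        [ ∈-++⁺ˡ
        , ∈-++⁺ʳ (traversed Aw) ∘
          [ ∈-++⁺ʳ (traversed (walk K′)) ∘ ∈-++⁺ˡ
          , [ ∈-++⁺ʳ (traversed (walk K′)) ∘ ∈-++⁺ʳ (traversed Bw) ∘ Any.reverse⁺ , ∈-++⁺ˡ ]′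
          ]′
        ]′

  aPoint-injective : Injective _≡_ _≡_ aPoint
  aPoint-injective = triple-injective T.i₁≢i₂ T.i₁≢i₃ T.i₂≢i₃

  bPoint-injective : Injective _≡_ _≡_ bPoint
  bPoint-injective = triple-injective T.j₁≢j₂ T.j₁≢j₃ T.j₂≢j₃

  record ThetaThrough {x y} (r : Arc (aPoint x) (aPoint y)) (jb : Fin (3 + T.pB)) : Set₁ where
    field
      Bw : Walk (T.β (bPoint y)) (T.β (bPoint x))
      Bw-along : Along B.OnCycle B.EdgeOfCycle Bw
      cB∈Bw : T.cB jb ∈ traversed Bw
      circuit : IsCircuit G (ThetaEdge (A.arcWalk r) Bw (connector x) (connector y))

  theta-through : ∀ {x y} → x ≢ y → (r : Arc (aPoint x) (aPoint y)) → ∀ jb → ThetaThrough r jb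
  theta-through {x} {y} x≢y r jb = choose (arc-covering (x≢y ∘ sym ∘ bPoint-injective) jb)
    where
      theta : ∀ {Bw} → Along B.OnCycle B.EdgeOfCycle Bw → IsCircuit G (ThetaEdge (A.arcWalk r) Bw (connector x) (connector y))
      theta = theta-circuit (connector x) (connector y) (connector-inner-disjoint x≢y) (A.arcWalk r) (A.arcWalk-along r)
        (walk-nonempty (x≢y ∘ aPoint-injective ∘ T.α-inj) (A.arcWalk r)) _

      choose : _ → ThetaThrough r jb
      choose (inj₁ (s , covers)) = record
        { Bw = B.arcWalk s ; Bw-along = B.arcWalk-along s ; cB∈Bw = B.arcWalk-covers s covers ; circuit = theta (B.arcWalk-along s) }
      choose (inj₂ (s , covers)) = record
        { Bw = reverseʷ (B.arcWalk s)
        ; Bw-along = along-reverse (B.arcWalk-along s)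
        ; cB∈Bw = subst (_ ∈_) (sym (traversed-reverse (B.arcWalk s))) (Any.reverse⁺ (B.arcWalk-covers s covers))
        ; circuit = theta (along-reverse (B.arcWalk-along s))
        }

-- Circuit injections

module CircuitInjection (G G′ : Graph) (X : TypeX G) (f : E G → E G′) (ci : IsCircuitInjection G G′ f) where
  open TypeXGraph G X
  open Walks G using (traversed; Along)
  open Incidence G′ using (Separated)
  private
    module T = TypeX X
    module CI = IsCircuitInjection ci
    module G′ = Circuit G′

  ImageA ImageB : E G′ → Set
  ImageA = Image {G} {G′} f A.EdgeOfCycle
  ImageB = Image {G} {G′} f B.EdgeOfCycle

  cycleA-circuit : IsCircuit G A.EdgeOfCycle
  cycleA-circuit = T.pA , T.α , T.cA , T.α-inj , T.cA-joins , (λ _ → id) , (λ i → i , refl)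

  images-separated : Separated ImageA ImageB
  images-separated (a , (i , refl) , refl) (b , (j , refl) , refl) a∋w b∋w
    with G′.other-edge (CI.circuits _ cycleA-circuit) (a , (i , refl) , refl) a∋w
  ... | _ , (a′ , (i′ , refl) , refl) , fa′≢fa , a′∋w with three-point-arc aPoint aPoint-injective i i′
  ... | record { from≢to = x≢y ; arc = r ; covers = covers ; covers′ = covers′ } =
    G′.degree≤2 (CI.circuits _ circuit) (a , inj₁ (A.arcWalk-covers r covers) , refl) (a′ , inj₁ (A.arcWalk-covers r covers′) , refl)
      (b , inj₂ (inj₁ cB∈Bw) , refl) (fa′≢fa ∘ sym) (not-B (i , refl)) (not-B (i′ , refl)) a∋w a′∋w b∋w
    where
      open ThetaThrough (theta-through x≢y r j)
      not-B : ∀ {e} → A.EdgeOfCycle e → f e ≢ f (T.cB j)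
      not-B e∈A fe≡fb = edgeA-edgeB e∈A (j , sym (CI.injective fe≡fb))

  imageA-not-connecting : ∀ {e i j a} → Joins G e (T.α i) (T.β j) → A.EdgeOfCycle a → f a ≢ f e
  imageA-not-connecting e-joins a∈A fa≡fe = connecting-not-edgeA e-joins (subst A.EdgeOfCycle (CI.injective fa≡fe) a∈A)

  imageB-not-connecting : ∀ {e i j b} → Joins G e (T.α i) (T.β j) → B.EdgeOfCycle b → f b ≢ f e
  imageB-not-connecting e-joins b∈B fb≡fe = connecting-not-edgeB e-joins (subst B.EdgeOfCycle (CI.injective fb≡fe) b∈B)

  image : ∀ {C e} → C e → Image {G} {G′} f C (f e)
  image e∈C = _ , e∈C , refl

  arc₁₂ : Arc T.i₁ T.i₂
  arc₁₂ = some-arc T.i₁ T.i₂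

  θ₁₂ : ThetaThrough arc₁₂ T.j₁
  θ₁₂ = theta-through {zero} {suc zero} (λ ()) arc₁₂ T.j₁

  D₁₂ : EdgeSet G
  D₁₂ = ThetaEdge (A.arcWalk arc₁₂) (ThetaThrough.Bw θ₁₂) (connector zero) (connector (suc zero))

  image-D₁₂-circuit : IsCircuit G′ (Image {G} {G′} f D₁₂)
  image-D₁₂-circuit = CI.circuits _ (ThetaThrough.circuit θ₁₂)

  e₁∈D₁₂ : D₁₂ T.e₁
  e₁∈D₁₂ = inj₂ (inj₂ (inj₁ (here refl)))

  e₂∈D₁₂ : D₁₂ T.e₂
  e₂∈D₁₂ = inj₂ (inj₂ (inj₂ (here refl)))

  cA∈D₁₂ : D₁₂ (T.cA T.i₁)
  cA∈D₁₂ = inj₁ (A.arcWalk-covers arc₁₂ (0 , ⊕-offset-nonzero T.i₁≢i₂ (Arc.ends arc₁₂) , refl))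

  cB∈D₁₂ : D₁₂ (T.cB T.j₁)
  cB∈D₁₂ = inj₂ (inj₁ (ThetaThrough.cB∈Bw θ₁₂))

  cA∈A : A.EdgeOfCycle (T.cA T.i₁)
  cA∈A = T.i₁ , refl

  cB∈B : B.EdgeOfCycle (T.cB T.j₁)
  cB∈B = T.j₁ , refl

  D₁₂-coloured : ∀ {e′} → Image {G} {G′} f D₁₂ e′ → e′ ≢ f T.e₁ → e′ ≢ f T.e₂ → ImageA e′ ⊎ ImageB e′
  D₁₂-coloured (e , inj₁ e∈Aw , refl) _ _ = inj₁ (e , Along.edge (A.arcWalk-along arc₁₂) e∈Aw , refl)
  D₁₂-coloured (e , inj₂ (inj₁ e∈Bw) , refl) _ _ = inj₂ (e , Along.edge (ThetaThrough.Bw-along θ₁₂) e∈Bw , refl)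
  D₁₂-coloured (_ , inj₂ (inj₂ (inj₁ (here refl))) , refl) ≢e₁ _ = contradiction refl ≢e₁
  D₁₂-coloured (_ , inj₂ (inj₂ (inj₂ (here refl))) , refl) _ ≢e₂ = contradiction refl ≢e₂

theorem5 : (G G' : Graph) (X : TypeX G) (f : E G → E G') → IsCircuitInjection G G' f → ¬ CommonVertex G' (f (e₁ X)) (f (e₂ X))
theorem5 G G′ X f ci common = Circuit.path-monochromatic G′ image-D₁₂-circuit images-separated
  (image e₁∈D₁₂) (image e₂∈D₁₂) (e₁≢e₂ ∘ CI.injective) common D₁₂-coloured
  (image cA∈D₁₂) (image cA∈A) (imageA-not-connecting T.e₁-joins cA∈A) (imageA-not-connecting T.e₂-joins cA∈A)
  (image cB∈D₁₂) (image cB∈B) (imageB-not-connecting T.e₁-joins cB∈B) (imageB-not-connecting T.e₂-joins cB∈B)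
  where
    open CircuitInjection G G′ X f ci
    open TypeXGraph G X using (e₁≢e₂)
    module T = TypeX X
    module CI = IsCircuitInjection ci
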